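{- Let $G=(V,E)$ be a graph and construct $G'$ from $G$ as follows: for each vertex $v\in V$, with $D=d_G(v)+1$, add new vertices $x_i,y_i,z_i$ for $i\in\{1,\dots,D\}$ with edges $v x_i$, $x_i y_i$, $y_i z_i$; add two new pendant vertices adjacent to each $z_i$; add two new pendant vertices adjacent to $y_1$; and add one new pendant vertex adjacent to each $y_i$ for $i\in\{2,\dots,D\}$ (new vertices distinct for distinct $v$; $G'$ contains $G$). If $G$ is a circle graph, then $G'$ is a circle graph.
   Context: A graph is a circle graph if it is the intersection graph of a set of chords of a circle, i.e., there is a circle model in which vertices correspond to chords and two vertices are adjacent if and only if their chords intersect. A pendant vertex is a vertex of degree one. -}

module Defs where

open import Data.Nat using (ℕ; suc; _<_)
open import Data.Fin using (Fin; zero; suc)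
open import Data.Bool using (Bool; true)
open import Data.List using (length; filterᵇ; allFin)
open import Data.Product using (Σ; _×_; _,_)
open import Data.Sum using (_⊎_)
open import Relation.Binary.PropositionalEquality using (_≡_; _≢_)
open import Relation.Nullary using (¬_)
open import Function.Bundles using (_⇔_)

-- A circle model of a graph with vertex type V and adjacency Adj assigns
-- to every vertex v a chord with endpoints l v < r v, where endpoints are
-- points on the circle, recorded by their position (a natural number) in
-- the cyclic order read from a fixed base point that is not an endpoint.

record CircleModel {V : Set} (Adj : V → V → Set) : Set where
  field
    l r       : V → ℕ
    l<r       : ∀ v → l v < r v
    l-inj     : ∀ u v → l u ≡ l v → u ≡ v
    r-inj     : ∀ u v → r u ≡ r v → u ≡ v
    l≢r       : ∀ u v → l u ≢ r v
    adj⇔cross : ∀ u v → Adj u v ⇔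
                  ((l u < l v × l v < r u × r u < r v) ⊎
                   (l v < l u × l u < r v × r v < r u))

IsCircleGraph : {V : Set} → (V → V → Set) → Set
IsCircleGraph Adj = CircleModel Adj

record Graph : Set where
  field
    n     : ℕ
    adj   : Fin n → Fin n → Bool
    sym   : ∀ u v → adj u v ≡ adj v u
    irr   : ∀ v → ¬ (adj v v ≡ true)

  Adj : Fin n → Fin n → Set
  Adj u v = adj u v ≡ true

  degree : Fin n → ℕ
  degree v = length (filterᵇ (adj v) (allFin n))

-- The construction G'.  For v with D = deg v + 1, the index i ∈ {1..D}
-- is represented by Fin (suc (deg v)), with zero standing for i = 1 and
-- suc j (j : Fin (deg v)) for i = j + 2.

module Construction (G : Graph) where
  open Graph G

  data V' : Set where
    old  : Fin n → V'
    x y z : (v : Fin n) → Fin (suc (degree v)) → V'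
    zp   : (v : Fin n) → Fin (suc (degree v)) → Fin 2 → V'
    y1p  : (v : Fin n) → Fin 2 → V'
    yip  : (v : Fin n) → Fin (degree v) → V'

  data E : V' → V' → Set where
    e-old : ∀ {u w} → Adj u w → E (old u) (old w)
    e-vx  : ∀ {v i} → E (old v) (x v i)
    e-xy  : ∀ {v i} → E (x v i) (y v i)
    e-yz  : ∀ {v i} → E (y v i) (z v i)
    e-zp  : ∀ {v i j} → E (z v i) (zp v i j)
    e-y1p : ∀ {v j} → E (y v zero) (y1p v j)
    e-yip : ∀ {v j} → E (y v (suc j)) (yip v j)

  Adj' : V' → V' → Set
  Adj' a b = E a b ⊎ E b a

module Submission where

-- Adding pendant vertices preserves circle graphs.  Blow every endpoint position p of a circle model
-- up into a block of S = 2B + 1 consecutive positions, keeping the old endpoint in the middle slot B.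
-- A pendant a of u, with index i < B among the pendants of u, gets the chord from slot i to slot 2B − i
-- of the block of the left endpoint of u: it crosses the chord of u and no other old chord, and the
-- chords of the pendants of u are pairwise nested.  G' is G after four rounds of adding pendants:
-- the x_i; the y_i; the z_i together with the pendants of the y_i; the pendants of the z_i.

open import Defs
open import Data.Nat using (ℕ; suc; _+_; _*_; _∸_; _<_; _≤_; s≤s)
open import Data.Nat.Properties
open import Data.Fin using (Fin; zero; suc; toℕ; inject≤)
open import Data.Fin.Properties using (toℕ<n; toℕ-injective; inject≤-injective)
open import Data.List using (allFin)
open import Data.List.Properties using (length-filter; length-tabulate)
open import Data.Bool.Properties using (T?)
open import Data.Product using (Σ; _×_; _,_; proj₁; proj₂; uncurry)
open import Data.Product.Function.NonDependent.Propositional using (_×-⇔_)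
open import Data.Sum using (_⊎_; inj₁; inj₂; swap; [_,_])
open import Data.Sum.Function.Propositional using (_⊎-⇔_)
open import Data.Empty using (⊥; ⊥-elim)
open import Function using (_∘_; id)
open import Function.Bundles using (_⇔_; mk⇔; Equivalence)
import Function.Properties.Equivalence as ⇔
open import Relation.Binary.PropositionalEquality hiding ([_])
open import Relation.Nullary using (¬_)
open import Relation.Binary.Definitions using (tri<; tri≈; tri>)

Crossing : ℕ → ℕ → ℕ → ℕ → Set
Crossing lu ru lv rv = (lu < lv × lv < ru × ru < rv) ⊎ (lv < lu × lu < rv × rv < ru)

Crossing-cong : (h : ℕ → ℕ) → (∀ {m n} → m < n ⇔ h m < h n) →
                ∀ a b c d → Crossing a b c d ⇔ Crossing (h a) (h b) (h c) (h d)
Crossing-cong h mono _ _ _ _ = (mono ×-⇔ mono ×-⇔ mono) ⊎-⇔ (mono ×-⇔ mono ×-⇔ mono)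

module _ {V : Set} {A : V → V → Set} (M : CircleModel A) where
  open CircleModel M

  adj-sym : ∀ u v → A u v → A v u
  adj-sym u v h = Equivalence.from (adj⇔cross v u) (swap (Equivalence.to (adj⇔cross u v) h))

  pullback : {W : Set} {B : W → W → Set} (f : W → V) → (∀ a b → f a ≡ f b → a ≡ b) →
             (∀ a b → B a b ⇔ A (f a) (f b)) → CircleModel B
  pullback f f-inj B⇔A = record
    { l = l ∘ f ; r = r ∘ f ; l<r = l<r ∘ f
    ; l-inj = λ a b → f-inj a b ∘ l-inj (f a) (f b)
    ; r-inj = λ a b → f-inj a b ∘ r-inj (f a) (f b)
    ; l≢r = λ a b → l≢r (f a) (f b)
    ; adj⇔cross = λ a b → ⇔.trans (B⇔A a b) (adj⇔cross (f a) (f b)) }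

module Blocks (S : ℕ) where
  opaque
    slot : ℕ → ℕ → ℕ
    slot p k = p * S + k

  opaque
    unfolding slot

    slot-<-block : ∀ {p q k k'} → p < q → k < S → slot p k < slot q k'
    slot-<-block {p} {q} {k} {k'} p<q k<S = begin-strict
        p * S + k   <⟨ +-monoʳ-< (p * S) k<S ⟩
        p * S + S   ≡⟨ +-comm (p * S) S ⟩
        suc p * S   ≤⟨ *-monoˡ-≤ S p<q ⟩
        q * S       ≤⟨ m≤m+n (q * S) k' ⟩
        q * S + k'  ∎
      where open ≤-Reasoning

    slot-<-offset : ∀ {p k k'} → k < k' → slot p k < slot p k'
    slot-<-offset {p} = +-monoʳ-< (p * S)

    slot-<-offset⁻¹ : ∀ {p q k k'} → slot p k < slot q k' → p ≡ q → k < k'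
    slot-<-offset⁻¹ {p} {k = k} {k'} h refl = +-cancelˡ-< (p * S) k k' h

    slot-injective : ∀ {p q k k'} → k < S → k' < S → slot p k ≡ slot q k' → p ≡ q × k ≡ k'
    slot-injective {p} {q} {k} {k'} k<S k'<S h with <-cmp p q
    ... | tri< p<q _ _ = ⊥-elim (<-irrefl h (slot-<-block p<q k<S))
    ... | tri≈ _ refl _ = refl , +-cancelˡ-≡ (p * S) k k' h
    ... | tri> _ _ q<p = ⊥-elim (<-irrefl (sym h) (slot-<-block q<p k'<S))

  slot-injectiveʳ : ∀ {p q k k'} → k < S → k' < S → slot p k ≡ slot q k' → k ≡ k'
  slot-injectiveʳ k<S k'<S = proj₂ ∘ slot-injective k<S k'<S

  slot-<-block⁻¹ : ∀ {p q k} → k < S → slot p k < slot q k → p < q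
  slot-<-block⁻¹ {p} {q} k<S h with <-cmp p q
  ... | tri< p<q _ _ = p<q
  ... | tri≈ _ refl _ = ⊥-elim (<-irrefl refl (slot-<-offset⁻¹ h refl))
  ... | tri> _ _ q<p = ⊥-elim (<-asym h (slot-<-block q<p k<S))

  slot-between : ∀ {p q k k' k''} → k' < S → k'' < S →
                 slot p k < slot q k' → slot q k' < slot p k'' → p ≡ q
  slot-between {p} {q} k'<S k''<S h h' with <-cmp p q
  ... | tri< p<q _ _ = ⊥-elim (<-asym h' (slot-<-block p<q k''<S))
  ... | tri≈ _ p≡q _ = p≡q
  ... | tri> _ _ q<p = ⊥-elim (<-asym h (slot-<-block q<p k'<S))

WithPendants : {V N : Set} → (V → V → Set) → (N → V) → V ⊎ N → V ⊎ N → Set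
WithPendants A par (inj₁ u) (inj₁ w) = A u w
WithPendants A par (inj₁ u) (inj₂ a) = par a ≡ u
WithPendants A par (inj₂ a) (inj₁ u) = par a ≡ u
WithPendants A par (inj₂ a) (inj₂ b) = ⊥

WithPendants-hom : {V N W : Set} {A : V → V → Set} {par : N → V}
                   (R : W → W → Set) → (∀ {s t} → R s t → R t s) →
                   (g : V → W) (h : N → W) →
                   (∀ u w → A u w → R (g u) (g w)) → (∀ a → R (g (par a)) (h a)) →
                   ∀ s t → WithPendants A par s t → R ([ g , h ] s) ([ g , h ] t)
WithPendants-hom R R-sym g h hom pendant (inj₁ u) (inj₁ w) e    = hom u w e
WithPendants-hom R R-sym g h hom pendant (inj₁ u) (inj₂ a) refl = pendant a
WithPendants-hom R R-sym g h hom pendant (inj₂ a) (inj₁ u) refl = R-sym (pendant a)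

module Pendants {V N : Set} {A : V → V → Set} (M : CircleModel A) (par : N → V)
  (B : ℕ) (idx : N → Fin B) (idx-inj : ∀ a b → par a ≡ par b → idx a ≡ idx b → a ≡ b) where
  open CircleModel M

  S : ℕ
  S = suc (B + B)
  open Blocks S

  lslot rslot : N → ℕ
  lslot a = toℕ (idx a)
  rslot a = (B + B) ∸ lslot a

  lslot<B : ∀ a → lslot a < B
  lslot<B a = toℕ<n (idx a)

  B<rslot : ∀ a → B < rslot a
  B<rslot a = subst (_< rslot a) (m+n∸n≡m B B) (∸-monoʳ-< (lslot<B a) (m≤n+m B B))

  lslot≤B+B : ∀ a → lslot a ≤ B + B
  lslot≤B+B a = ≤-trans (<⇒≤ (lslot<B a)) (m≤m+n B B)

  rslot-antitone : ∀ {a b} → lslot a < lslot b → rslot b < rslot a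
  rslot-antitone {b = b} ia<ib = ∸-monoʳ-< ia<ib (lslot≤B+B b)

  rslot-injective : ∀ {a b} → rslot a ≡ rslot b → lslot a ≡ lslot b
  rslot-injective {a} {b} = ∸-cancelˡ-≡ (lslot≤B+B a) (lslot≤B+B b)

  B<S : B < S
  B<S = s≤s (m≤m+n B B)

  lslot<S : ∀ a → lslot a < S
  lslot<S a = <-trans (lslot<B a) B<S

  rslot<S : ∀ a → rslot a < S
  rslot<S a = s≤s (m∸n≤m (B + B) (lslot a))

  L R : V ⊎ N → ℕ
  L (inj₁ u) = slot (l u) B
  L (inj₂ a) = slot (l (par a)) (lslot a)
  R (inj₁ u) = slot (r u) B
  R (inj₂ a) = slot (l (par a)) (rslot a)

  L<R : ∀ s → L s < R s
  L<R (inj₁ u) = slot-<-block (l<r u) B<S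
  L<R (inj₂ a) = slot-<-offset (<-trans (lslot<B a) (B<rslot a))

  slot-pendant-injective : ∀ a b → l (par a) ≡ l (par b) → lslot a ≡ lslot b → a ≡ b
  slot-pendant-injective a b e e' = idx-inj a b (l-inj _ _ e) (toℕ-injective e')

  L-inj : ∀ s t → L s ≡ L t → s ≡ t
  L-inj (inj₁ u) (inj₁ w) h = cong inj₁ (l-inj u w (proj₁ (slot-injective B<S B<S h)))
  L-inj (inj₁ u) (inj₂ b) h = ⊥-elim (<-irrefl (sym (slot-injectiveʳ B<S (lslot<S b) h)) (lslot<B b))
  L-inj (inj₂ a) (inj₁ w) h = ⊥-elim (<-irrefl (slot-injectiveʳ (lslot<S a) B<S h) (lslot<B a))
  L-inj (inj₂ a) (inj₂ b) h with slot-injective (lslot<S a) (lslot<S b) h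
  ... | e , e' = cong inj₂ (slot-pendant-injective a b e e')

  R-inj : ∀ s t → R s ≡ R t → s ≡ t
  R-inj (inj₁ u) (inj₁ w) h = cong inj₁ (r-inj u w (proj₁ (slot-injective B<S B<S h)))
  R-inj (inj₁ u) (inj₂ b) h = ⊥-elim (<-irrefl (slot-injectiveʳ B<S (rslot<S b) h) (B<rslot b))
  R-inj (inj₂ a) (inj₁ w) h = ⊥-elim (<-irrefl (sym (slot-injectiveʳ (rslot<S a) B<S h)) (B<rslot a))
  R-inj (inj₂ a) (inj₂ b) h with slot-injective (rslot<S a) (rslot<S b) h
  ... | e , e' = cong inj₂ (slot-pendant-injective a b e (rslot-injective e'))

  L≢R : ∀ s t → L s ≢ R t
  L≢R (inj₁ u) (inj₁ w) h = l≢r u w (proj₁ (slot-injective B<S B<S h))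
  L≢R (inj₁ u) (inj₂ b) h = <-irrefl (slot-injectiveʳ B<S (rslot<S b) h) (B<rslot b)
  L≢R (inj₂ a) (inj₁ w) h = <-irrefl (slot-injectiveʳ (lslot<S a) B<S h) (lslot<B a)
  L≢R (inj₂ a) (inj₂ b) h =
    <-irrefl (slot-injectiveʳ (lslot<S a) (rslot<S b) h) (<-trans (lslot<B a) (B<rslot b))

  crossing-old : ∀ u w → A u w ⇔ Crossing (L (inj₁ u)) (R (inj₁ u)) (L (inj₁ w)) (R (inj₁ w))
  crossing-old u w =
    ⇔.trans (adj⇔cross u w) (Crossing-cong (λ p → slot p B) block-mono (l u) (r u) (l w) (r w))
    where
    block-mono : ∀ {p q} → p < q ⇔ slot p B < slot q B
    block-mono = mk⇔ (λ p<q → slot-<-block p<q B<S) (slot-<-block⁻¹ B<S)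

  crossing-pendant : ∀ u a →
                     (par a ≡ u) ⇔ Crossing (L (inj₁ u)) (R (inj₁ u)) (L (inj₂ a)) (R (inj₂ a))
  crossing-pendant u a = mk⇔ to from
    where
    to : par a ≡ u → Crossing (L (inj₁ u)) (R (inj₁ u)) (L (inj₂ a)) (R (inj₂ a))
    to refl =
      inj₂ (slot-<-offset (lslot<B a) , slot-<-offset (B<rslot a) , slot-<-block (l<r u) (rslot<S a))
    from : Crossing (L (inj₁ u)) (R (inj₁ u)) (L (inj₂ a)) (R (inj₂ a)) → par a ≡ u
    from (inj₁ (_ , La<Ru , Ru<Ra)) = ⊥-elim (l≢r _ _ (slot-between B<S (rslot<S a) La<Ru Ru<Ra))
    from (inj₂ (La<Lu , Lu<Ra , _)) = l-inj _ _ (slot-between B<S (rslot<S a) La<Lu Lu<Ra)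

  pendants-nested : ∀ a b → ¬ Crossing (L (inj₂ a)) (R (inj₂ a)) (L (inj₂ b)) (R (inj₂ b))
  pendants-nested a b (inj₁ (La<Lb , Lb<Ra , Ra<Rb)) =
    <-asym (slot-<-offset⁻¹ Ra<Rb same) (rslot-antitone (slot-<-offset⁻¹ La<Lb same))
    where
    same : l (par a) ≡ l (par b)
    same = slot-between (lslot<S b) (rslot<S a) La<Lb Lb<Ra
  pendants-nested a b (inj₂ crossing) = pendants-nested b a (inj₁ crossing)

  circleModel : CircleModel (WithPendants A par)
  circleModel = record
    { l = L ; r = R ; l<r = L<R ; l-inj = L-inj ; r-inj = R-inj ; l≢r = L≢R ; adj⇔cross = crossing }
    where
    crossing : ∀ s t → WithPendants A par s t ⇔ Crossing (L s) (R s) (L t) (R t)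
    crossing (inj₁ u) (inj₁ w) = crossing-old u w
    crossing (inj₁ u) (inj₂ b) = crossing-pendant u b
    crossing (inj₂ a) (inj₁ w) = ⇔.trans (crossing-pendant w a) (mk⇔ swap swap)
    crossing (inj₂ a) (inj₂ b) = mk⇔ (λ ()) (pendants-nested a b)

module Layers (G : Graph) where
  open Graph G
  open Construction G

  degree≤n : ∀ v → degree v ≤ n
  degree≤n v = ≤-trans (length-filter (T? ∘ adj v) (allFin n)) (≤-reflexive (length-tabulate id))

  Legs : Set
  Legs = Σ (Fin n) (λ v → Fin (suc (degree v)))

  YChildren : Set
  YChildren = Legs ⊎ (Fin n × Fin 2) ⊎ Σ (Fin n) (λ v → Fin (degree v))

  V₁ V₂ V₃ V₄ : Set
  V₁ = Fin n ⊎ Legs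
  V₂ = V₁ ⊎ Legs
  V₃ = V₂ ⊎ YChildren
  V₄ = V₃ ⊎ (Legs × Fin 2)

  yParent : YChildren → V₂
  yParent (inj₁ s)              = inj₂ s
  yParent (inj₂ (inj₁ (v , _))) = inj₂ (v , zero)
  yParent (inj₂ (inj₂ (v , j))) = inj₂ (v , suc j)

  zParent : Legs × Fin 2 → V₃
  zParent (s , _) = inj₂ (inj₁ s)

  Adj₁ : V₁ → V₁ → Set
  Adj₁ = WithPendants Adj proj₁
  Adj₂ : V₂ → V₂ → Set
  Adj₂ = WithPendants Adj₁ inj₂
  Adj₃ : V₃ → V₃ → Set
  Adj₃ = WithPendants Adj₂ yParent
  Adj₄ : V₄ → V₄ → Set
  Adj₄ = WithPendants Adj₃ zParent

  layeredModel : CircleModel Adj → CircleModel Adj₄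
  layeredModel M = M₄
    where
    M₁ : CircleModel Adj₁
    M₁ = Pendants.circleModel M proj₁ (suc n) xIndex xIndex-inj
      where
      xIndex : Legs → Fin (suc n)
      xIndex (v , i) = inject≤ i (s≤s (degree≤n v))
      xIndex-inj : ∀ s t → proj₁ s ≡ proj₁ t → xIndex s ≡ xIndex t → s ≡ t
      xIndex-inj (v , i) (.v , j) refl e = cong (v ,_) (inject≤-injective _ _ i j e)
    M₂ : CircleModel Adj₂
    M₂ = Pendants.circleModel M₁ inj₂ 1 (λ _ → zero) λ { s .s refl _ → refl }
    M₃ : CircleModel Adj₃
    M₃ = Pendants.circleModel M₂ yParent 3 yIndex yIndex-inj
      where
      yIndex : YChildren → Fin 3
      yIndex (inj₁ _)              = zero
      yIndex (inj₂ (inj₁ (_ , j))) = suc j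
      yIndex (inj₂ (inj₂ _))       = suc zero
      yIndex-inj : ∀ a b → yParent a ≡ yParent b → yIndex a ≡ yIndex b → a ≡ b
      yIndex-inj (inj₁ s)         (inj₁ .s)        refl _    = refl
      yIndex-inj (inj₁ _)         (inj₂ (inj₁ _))  _    ()
      yIndex-inj (inj₁ _)         (inj₂ (inj₂ _))  _    ()
      yIndex-inj (inj₂ (inj₁ _))  (inj₁ _)         _    ()
      yIndex-inj (inj₂ (inj₂ _))  (inj₁ _)         _    ()
      yIndex-inj (inj₂ (inj₁ _))  (inj₂ (inj₁ _))  refl refl = refl
      yIndex-inj (inj₂ (inj₁ _))  (inj₂ (inj₂ _))  ()   _
      yIndex-inj (inj₂ (inj₂ _))  (inj₂ (inj₁ _))  ()   _
      yIndex-inj (inj₂ (inj₂ _))  (inj₂ (inj₂ _))  refl _    = refl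
    M₄ : CircleModel Adj₄
    M₄ = Pendants.circleModel M₃ zParent 2 (λ (_ , j) → j) λ { (s , j) (.s , .j) refl refl → refl }

  toLayered : V' → V₄
  toLayered (old v)    = inj₁ (inj₁ (inj₁ (inj₁ v)))
  toLayered (x v i)    = inj₁ (inj₁ (inj₁ (inj₂ (v , i))))
  toLayered (y v i)    = inj₁ (inj₁ (inj₂ (v , i)))
  toLayered (z v i)    = inj₁ (inj₂ (inj₁ (v , i)))
  toLayered (y1p v j)  = inj₁ (inj₂ (inj₂ (inj₁ (v , j))))
  toLayered (yip v j)  = inj₁ (inj₂ (inj₂ (inj₂ (v , j))))
  toLayered (zp v i j) = inj₂ ((v , i) , j)

  toLayered-edge : ∀ {a b} → E a b → Adj₄ (toLayered a) (toLayered b)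
  toLayered-edge (e-old h) = h
  toLayered-edge e-vx      = refl
  toLayered-edge e-xy      = refl
  toLayered-edge e-yz      = refl
  toLayered-edge e-zp      = refl
  toLayered-edge e-y1p     = refl
  toLayered-edge e-yip     = refl

  yChild : YChildren → V'
  yChild = [ uncurry z , [ uncurry y1p , uncurry yip ] ]

  zChild : Legs × Fin 2 → V'
  zChild ((v , i) , j) = zp v i j

  from₁ : V₁ → V'
  from₁ = [ old , uncurry x ]
  from₂ : V₂ → V'
  from₂ = [ from₁ , uncurry y ]
  from₃ : V₃ → V'
  from₃ = [ from₂ , yChild ]
  fromLayered : V₄ → V'
  fromLayered = [ from₃ , zChild ]

  fromLayered-toLayered : ∀ a → fromLayered (toLayered a) ≡ a
  fromLayered-toLayered (old _)     = refl
  fromLayered-toLayered (x _ _)     = refl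
  fromLayered-toLayered (y _ _)     = refl
  fromLayered-toLayered (z _ _)     = refl
  fromLayered-toLayered (y1p _ _)   = refl
  fromLayered-toLayered (yip _ _)   = refl
  fromLayered-toLayered (zp _ _ _)  = refl

  toLayered-injective : ∀ a b → toLayered a ≡ toLayered b → a ≡ b
  toLayered-injective a b e = begin
    a                         ≡⟨ fromLayered-toLayered a ⟨
    fromLayered (toLayered a) ≡⟨ cong fromLayered e ⟩
    fromLayered (toLayered b) ≡⟨ fromLayered-toLayered b ⟩
    b                         ∎
    where open ≡-Reasoning

  fromLayered-adj : ∀ s t → Adj₄ s t → Adj' (fromLayered s) (fromLayered t)
  fromLayered-adj = WithPendants-hom Adj' swap from₃ zChild from₃-adj (λ _ → inj₁ e-zp)
    where
    yChild-adj : ∀ a → Adj' (from₂ (yParent a)) (yChild a)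
    yChild-adj (inj₁ _)         = inj₁ e-yz
    yChild-adj (inj₂ (inj₁ _))  = inj₁ e-y1p
    yChild-adj (inj₂ (inj₂ _))  = inj₁ e-yip
    from₁-adj : ∀ s t → Adj₁ s t → Adj' (from₁ s) (from₁ t)
    from₁-adj = WithPendants-hom Adj' swap old (uncurry x) (λ _ _ → inj₁ ∘ e-old) (λ _ → inj₁ e-vx)
    from₂-adj : ∀ s t → Adj₂ s t → Adj' (from₂ s) (from₂ t)
    from₂-adj = WithPendants-hom Adj' swap from₁ (uncurry y) from₁-adj (λ _ → inj₁ e-xy)
    from₃-adj : ∀ s t → Adj₃ s t → Adj' (from₃ s) (from₃ t)
    from₃-adj = WithPendants-hom Adj' swap from₂ yChild from₂-adj yChild-adj

  toLayered-adj⁻¹ : ∀ a b → Adj₄ (toLayered a) (toLayered b) → Adj' a b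
  toLayered-adj⁻¹ a b h = subst₂ Adj' (fromLayered-toLayered a) (fromLayered-toLayered b)
                                      (fromLayered-adj (toLayered a) (toLayered b) h)

mainTheorem6 : (G : Graph) → IsCircleGraph (Graph.Adj G) →
    IsCircleGraph (Construction.Adj' G)
mainTheorem6 G M = pullback M₄ toLayered toLayered-injective adjacency
  where
  open Layers G
  M₄ : CircleModel Adj₄
  M₄ = layeredModel M
  adjacency : ∀ a b → Construction.Adj' G a b ⇔ Adj₄ (toLayered a) (toLayered b)
  adjacency a b = mk⇔ [ toLayered-edge , adj-sym M₄ (toLayered b) (toLayered a) ∘ toLayered-edge ]
                      (toLayered-adj⁻¹ a b)
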